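{- Consider the construction described in the context. For all distinct $i,j\in[k]$, all distinct $i',i''\in[n]$ and all distinct $j',j''\in[n]$: (1) $d(u'_{i,i'},u_{i,i''})+d(u_{i,i''},u'_{j,j'})\le(1+\alpha)\cdot d(u'_{i,i'},u'_{j,j'})$; (2) $d(u'_{j,j'},u_{j,j''})+d(u_{j,j''},u'_{i,i'})\le(1+\alpha)\cdot d(u'_{i,i'},u'_{j,j'})$.
   Context: Fix integers $k\ge 2$ and odd $n$, and rational $\alpha$ with $0<\alpha\le 0.5$; set $L=\lceil n/(2\alpha)\rceil$, $L_p=\lceil (n-1)/\alpha\rceil$. The graph $G'$ (unweighted; $d$ denotes its shortest-path distance) is built as follows: a vertex $b$; for each $i\in[k]$: vertices $u'_{i,1},\dots,u'_{i,n}$ forming a path in this order, vertices $u_{i,1},\dots,u_{i,n}$ forming a path in this order, a vertex $z_i$ adjacent to $u'_{i,1}$ and $u_{i,n}$, a vertex $z'_i$ adjacent to $u'_{i,n}$ and $u_{i,1}$, and a vertex $p_i$ joined to $u_{i,(n+1)/2}$ by a path with $L_p-1$ new internal vertices; for each $i\in[k]$, $j\in[n]$: a path from $u_{i,j}$ to $b$ with $L-1$ new internal vertices and a path from $u'_{i,j}$ to $b$ with $L-1$ new internal vertices. -}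

module Defs where

open import Data.Nat using (ℕ; zero; suc; _+_; _*_; _∸_; _≤_)
open import Data.Fin using (Fin; toℕ)
open import Data.Integer using (+_; ∣_∣)
open import Data.Rational using (ℚ; _/_; 0ℚ; _<_; 1/_; ceiling; positive)
import Data.Rational as Q
open import Data.Rational.Properties using (pos⇒nonZero)
open import Data.Product using (_×_)
open import Data.Sum using (_⊎_)
open import Relation.Binary.PropositionalEquality using (_≡_)

ℕtoℚ : ℕ → ℚ
ℕtoℚ m = + m / 1

Lof : (n : ℕ) (α : ℚ) → 0ℚ < α → ℕ
Lof n α h = ∣ ceiling ((+ n / 2) Q.* (1/ α)) ∣
  where instance _ = pos⇒nonZero α {{positive h}}

Lpof : (n : ℕ) (α : ℚ) → 0ℚ < α → ℕ
Lpof n α h = ∣ ceiling ((+ (n ∸ 1) / 1) Q.* (1/ α)) ∣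
  where instance _ = pos⇒nonZero α {{positive h}}

-- Vertices of G' (parameters k, n, L, Lp).
--   u' i j, u i j         : the vertices u'_{i,j+1}, u_{i,j+1}  (0-based j)
--   z i, z' i             : z_i, z'_i
--   pv i t  (t : Fin Lp)  : vertex at distance t+1 from u_{i,(n+1)/2} on the
--                           path towards p_i; pv i (Lp-1) is p_i itself, the
--                           others are the Lp-1 internal vertices
--   ub i j t, u'b i j t   : the L-1 internal vertices of the path from
--                           u_{i,j+1} (resp. u'_{i,j+1}) to b; t = 0 is next to u
data V (k n L Lp : ℕ) : Set where
  b    : V k n L Lp
  u'   : Fin k → Fin n → V k n L Lp
  u    : Fin k → Fin n → V k n L Lp
  z    : Fin k → V k n L Lp
  z'   : Fin k → V k n L Lp
  pv   : Fin k → Fin Lp → V k n L Lp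
  ub   : Fin k → Fin n → Fin (L ∸ 1) → V k n L Lp
  u'b  : Fin k → Fin n → Fin (L ∸ 1) → V k n L Lp

data E {k n L Lp : ℕ} : V k n L Lp → V k n L Lp → Set where
  e-u'u' : ∀ i (j j₁ : Fin n) → suc (toℕ j) ≡ toℕ j₁ → E (u' i j) (u' i j₁)
  e-uu   : ∀ i (j j₁ : Fin n) → suc (toℕ j) ≡ toℕ j₁ → E (u i j) (u i j₁)
  e-zu'  : ∀ i (j : Fin n) → toℕ j ≡ 0 → E (z i) (u' i j)
  e-zu   : ∀ i (j : Fin n) → suc (toℕ j) ≡ n → E (z i) (u i j)
  e-z'u' : ∀ i (j : Fin n) → suc (toℕ j) ≡ n → E (z' i) (u' i j)
  e-z'u  : ∀ i (j : Fin n) → toℕ j ≡ 0 → E (z' i) (u i j)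
  e-up   : ∀ i (j : Fin n) (t : Fin Lp) → 2 * toℕ j + 1 ≡ n → toℕ t ≡ 0 →
           E (u i j) (pv i t)
  e-pp   : ∀ i (t t₁ : Fin Lp) → suc (toℕ t) ≡ toℕ t₁ → E (pv i t) (pv i t₁)
  e-ub₀  : ∀ i j → L ≡ 1 → E (u i j) b
  e-ub₁  : ∀ i j (t : Fin (L ∸ 1)) → toℕ t ≡ 0 → E (u i j) (ub i j t)
  e-ubub : ∀ i j (t t₁ : Fin (L ∸ 1)) → suc (toℕ t) ≡ toℕ t₁ →
           E (ub i j t) (ub i j t₁)
  e-ubb  : ∀ i j (t : Fin (L ∸ 1)) → suc (toℕ t) ≡ L ∸ 1 → E (ub i j t) b
  e-u'b₀ : ∀ i j → L ≡ 1 → E (u' i j) b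
  e-u'b₁ : ∀ i j (t : Fin (L ∸ 1)) → toℕ t ≡ 0 → E (u' i j) (u'b i j t)
  e-u'bu'b : ∀ i j (t t₁ : Fin (L ∸ 1)) → suc (toℕ t) ≡ toℕ t₁ →
           E (u'b i j t) (u'b i j t₁)
  e-u'bb : ∀ i j (t : Fin (L ∸ 1)) → suc (toℕ t) ≡ L ∸ 1 → E (u'b i j t) b

Adj : ∀ {k n L Lp} → V k n L Lp → V k n L Lp → Set
Adj x y = E x y ⊎ E y x

data Walk {k n L Lp : ℕ} : V k n L Lp → V k n L Lp → ℕ → Set where
  here : ∀ {x} → Walk x x 0
  step : ∀ {x y w m} → Adj x y → Walk y w m → Walk x w (suc m)

IsDist : ∀ {k n L Lp} → V k n L Lp → V k n L Lp → ℕ → Set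
IsDist x y m = Walk x y m × (∀ m′ → Walk x y m′ → m ≤ m′)

G' : (k n : ℕ) (α : ℚ) → 0ℚ < α → Set
G' k n α h = V k n (Lof n α h) (Lpof n α h)

dG' : (k n : ℕ) (α : ℚ) (h : 0ℚ < α) → G' k n α h → G' k n α h → ℕ → Set
dG' k n α h x y m = IsDist x y m

{-# OPTIONS --safe #-}
module Submission where

open import Defs
open import Data.Nat as ℕ using (ℕ; zero; suc; _+_; _∸_; _≥_; _%_; z≤n; s≤s)
import Data.Nat.Properties as ℕ
open import Data.Nat.Tactic.RingSolver using (solve-∀)
open import Data.Integer.Tactic.RingSolver using () renaming (solve-∀ to solve-∀ℤ)
open import Data.Integer as ℤ using (+_; -[1+_]; +[1+_]; ∣_∣)
import Data.Integer.Properties as ℤ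
open import Data.Integer.DivMod using ([n/d]*d≤n)
open import Data.Fin using (Fin; toℕ; zero; fromℕ; fromℕ<)
open import Data.Fin.Properties using (toℕ-injective; toℕ<n; toℕ≤pred[n]; toℕ-fromℕ; toℕ-fromℕ<)
open import Data.Maybe using (Maybe; just; nothing)
open import Data.Maybe.Properties using (just-injective)
open import Data.Rational using (ℚ; mkℚ; 0ℚ; 1ℚ; ½; _<_; _≤_; _*_; ↥_; ↧ₙ_; ceiling; toℚᵘ; positive; nonNegative)
import Data.Rational as Q
import Data.Rational.Properties as Q
open import Data.Rational.Unnormalised as ᵘ using (mkℚᵘ; *≤*)
import Data.Rational.Unnormalised.Properties as ᵘ
open import Data.Product using (_×_; _,_; proj₁; proj₂)
open import Data.Sum using (_⊎_; inj₁; inj₂)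
open import Data.Empty using (⊥-elim)
open import Relation.Binary.Definitions using (tri<; tri≈; tri>)
open import Relation.Binary.PropositionalEquality

-- Deleting b splits G' into the branches i ∈ [k], and along every edge the height
-- (L on the vertices of a branch off its spokes, dropping by one along each spoke
-- to 0 at b) changes by at most one; so a walk between two branches has length at
-- least 2L.  On the other hand u'_{i,i'} reaches u_{i,i''} in at most n steps around
-- the cycle u'_{i,1} … u'_{i,n} z'_i u_{i,1} … u_{i,n} z_i, and u_{i,i''} reaches
-- u'_{j,j'} in 2L steps through b.  Since L ≥ n/(2α), each left-hand side is at most
-- n + 2L ≤ (1 + α) 2L ≤ (1 + α) d(u'_{i,i'}, u'_{j,j'}).

AtMostOneApart : ℕ → ℕ → Set
AtMostOneApart m m′ = m ℕ.≤ suc m′ × m′ ℕ.≤ suc m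

module _ {k n L Lp : ℕ} where

  private
    Vertex : Set
    Vertex = V k n L Lp

  Adj-sym : {x y : Vertex} → Adj x y → Adj y x
  Adj-sym (inj₁ e) = inj₂ e
  Adj-sym (inj₂ e) = inj₁ e

  infixr 5 _++ʷ_

  _++ʷ_ : {x y w : Vertex} {m m′ : ℕ} → Walk x y m → Walk y w m′ → Walk x w (m + m′)
  here       ++ʷ w′ = w′
  step a w   ++ʷ w′ = step a (w ++ʷ w′)

  reverse-onto : {x y w : Vertex} {m m′ : ℕ} → Walk x y m → Walk x w m′ → Walk y w (m + m′)
  reverse-onto here acc = acc
  reverse-onto {y = y} {w} {suc m} {m′} (step a ws) acc =
    subst (Walk y w) (ℕ.+-suc m m′) (reverse-onto ws (step (Adj-sym a) acc))

  reverseʷ : {x y : Vertex} {m : ℕ} → Walk x y m → Walk y x m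
  reverseʷ {x} {y} {m} w = subst (Walk y x) (ℕ.+-identityʳ m) (reverse-onto w here)

  walk-along : ∀ {N} {f : Fin N → Vertex} →
               (∀ p q → suc (toℕ p) ≡ toℕ q → E (f p) (f q)) →
               ∀ d (p q : Fin N) → toℕ p + d ≡ toℕ q → Walk (f p) (f q) d
  walk-along edge zero p q p+0≡q with toℕ-injective (trans (sym (ℕ.+-identityʳ _)) p+0≡q)
  ... | refl = here
  walk-along {N} edge (suc d) p q p+1+d≡q =
    step (inj₁ (edge p p₁ (sym (toℕ-fromℕ< p₁<N)))) (walk-along edge d p₁ q p₁+d≡q)
    where
      1+p+d≡q : suc (toℕ p) + d ≡ toℕ q
      1+p+d≡q = trans (sym (ℕ.+-suc (toℕ p) d)) p+1+d≡q
      p₁<N : suc (toℕ p) ℕ.< N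
      p₁<N = ℕ.≤-<-trans (ℕ.m≤m+n _ d) (subst (ℕ._< N) (sym 1+p+d≡q) (toℕ<n q))
      p₁ : Fin N
      p₁ = fromℕ< p₁<N
      p₁+d≡q : toℕ p₁ + d ≡ toℕ q
      p₁+d≡q = trans (cong (_+ d) (toℕ-fromℕ< p₁<N)) 1+p+d≡q

  branch : Vertex → Maybe (Fin k)
  branch b           = nothing
  branch (u' i _)    = just i
  branch (u i _)     = just i
  branch (z i)       = just i
  branch (z' i)      = just i
  branch (pv i _)    = just i
  branch (ub i _ _)  = just i
  branch (u'b i _ _) = just i

  height : Vertex → ℕ
  height b           = 0
  height (ub _ _ t)  = L ∸ suc (toℕ t)
  height (u'b _ _ t) = L ∸ suc (toℕ t)
  height (u' _ _)    = L
  height (u _ _)     = L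
  height (z _)       = L
  height (z' _)      = L
  height (pv _ _)    = L

  private
    ∸-suc-near : ∀ m t → AtMostOneApart (m ∸ t) (m ∸ suc t)
    ∸-suc-near zero    zero    = z≤n , z≤n
    ∸-suc-near zero    (suc t) = z≤n , z≤n
    ∸-suc-near (suc m) zero    = ℕ.≤-refl , ℕ.m≤n+m m 2
    ∸-suc-near (suc m) (suc t) = ∸-suc-near m t

    m∸[m∸1]≤1 : ∀ m → m ∸ (m ∸ 1) ℕ.≤ 1
    m∸[m∸1]≤1 zero    = z≤n
    m∸[m∸1]≤1 (suc m) = ℕ.≤-reflexive (ℕ.m+n∸n≡m 1 m)

    level : AtMostOneApart L L
    level = ℕ.n≤1+n L , ℕ.n≤1+n L

  height-edge : {x y : Vertex} → E x y → AtMostOneApart (height x) (height y)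
  height-edge (e-u'u' _ _ _ _)   = level
  height-edge (e-uu _ _ _ _)     = level
  height-edge (e-zu' _ _ _)      = level
  height-edge (e-zu _ _ _)       = level
  height-edge (e-z'u' _ _ _)     = level
  height-edge (e-z'u _ _ _)      = level
  height-edge (e-up _ _ _ _ _)   = level
  height-edge (e-pp _ _ _ _)     = level
  height-edge (e-ub₀ _ _ refl)   = ℕ.≤-refl , z≤n
  height-edge (e-u'b₀ _ _ refl)  = ℕ.≤-refl , z≤n
  height-edge (e-ub₁ _ _ _ t≡0)  rewrite t≡0 = ∸-suc-near L 0
  height-edge (e-u'b₁ _ _ _ t≡0) rewrite t≡0 = ∸-suc-near L 0
  height-edge (e-ubub _ _ t _ next)   rewrite sym next = ∸-suc-near L (suc (toℕ t))
  height-edge (e-u'bu'b _ _ t _ next) rewrite sym next = ∸-suc-near L (suc (toℕ t))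
  height-edge (e-ubb _ _ _ last)  rewrite last = ℕ.≤-trans (m∸[m∸1]≤1 L) (s≤s z≤n) , z≤n
  height-edge (e-u'bb _ _ _ last) rewrite last = ℕ.≤-trans (m∸[m∸1]≤1 L) (s≤s z≤n) , z≤n

  height-adj : {x y : Vertex} → Adj x y → AtMostOneApart (height x) (height y)
  height-adj (inj₁ e) = height-edge e
  height-adj (inj₂ e) = let h , h′ = height-edge e in h′ , h

  height-walk : {x y : Vertex} {m : ℕ} → Walk x y m → height y ℕ.≤ m + height x
  height-walk here = ℕ.≤-refl
  height-walk {x} {m = suc m} (step a w) =
    ℕ.≤-trans (height-walk w)
      (ℕ.≤-trans (ℕ.+-monoʳ-≤ m (proj₂ (height-adj a))) (ℕ.≤-reflexive (ℕ.+-suc m (height x))))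

  branch-edge : {x y : Vertex} → E x y → branch x ≡ branch y ⊎ y ≡ b
  branch-edge (e-u'u' _ _ _ _)     = inj₁ refl
  branch-edge (e-uu _ _ _ _)       = inj₁ refl
  branch-edge (e-zu' _ _ _)        = inj₁ refl
  branch-edge (e-zu _ _ _)         = inj₁ refl
  branch-edge (e-z'u' _ _ _)       = inj₁ refl
  branch-edge (e-z'u _ _ _)        = inj₁ refl
  branch-edge (e-up _ _ _ _ _)     = inj₁ refl
  branch-edge (e-pp _ _ _ _)       = inj₁ refl
  branch-edge (e-ub₀ _ _ _)        = inj₂ refl
  branch-edge (e-ub₁ _ _ _ _)      = inj₁ refl
  branch-edge (e-ubub _ _ _ _ _)   = inj₁ refl
  branch-edge (e-ubb _ _ _ _)      = inj₂ refl
  branch-edge (e-u'b₀ _ _ _)       = inj₂ refl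
  branch-edge (e-u'b₁ _ _ _ _)     = inj₁ refl
  branch-edge (e-u'bu'b _ _ _ _ _) = inj₁ refl
  branch-edge (e-u'bb _ _ _ _)     = inj₂ refl

  leave-branch-via-b : {x y : Vertex} {i : Fin k} → Adj x y → branch x ≡ just i → branch y ≡ just i ⊎ y ≡ b
  leave-branch-via-b (inj₁ e) bx with branch-edge e
  ... | inj₁ bx≡by = inj₁ (trans (sym bx≡by) bx)
  ... | inj₂ y≡b   = inj₂ y≡b
  leave-branch-via-b (inj₂ e) bx with branch-edge e
  ... | inj₁ by≡bx = inj₁ (trans by≡bx bx)
  leave-branch-via-b (inj₂ e) () | inj₂ refl

  cross-branch-walk : {x y : Vertex} {i j : Fin k} {m : ℕ} →
                      branch x ≡ just i → branch y ≡ just j → i ≢ j →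
                      Walk x y m → height x + height y ℕ.≤ m
  cross-branch-walk bx by i≢j here = ⊥-elim (i≢j (just-injective (trans (sym bx) by)))
  cross-branch-walk {y = y} bx by i≢j (step a w) with leave-branch-via-b a bx
  ... | inj₁ bx₁ =
    ℕ.≤-trans (ℕ.+-monoˡ-≤ (height y) (proj₁ (height-adj a))) (s≤s (cross-branch-walk bx₁ by i≢j w))
  ... | inj₂ refl =
    ℕ.+-mono-≤ (proj₁ (height-adj a)) (ℕ.≤-trans (height-walk w) (ℕ.≤-reflexive (ℕ.+-identityʳ _)))

spoke-walk : ∀ {k n L Lp} {x : V k n L Lp} {s : Fin (L ∸ 1) → V k n L Lp} →
             (L ≡ 1 → E x b) → (∀ t → toℕ t ≡ 0 → E x (s t)) →
             (∀ t t′ → suc (toℕ t) ≡ toℕ t′ → E (s t) (s t′)) →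
             (∀ t → suc (toℕ t) ≡ L ∸ 1 → E (s t) b) →
             1 ℕ.≤ L → Walk x b L
spoke-walk {L = suc zero} x~b _ _ _ _ = step (inj₁ (x~b refl)) here
spoke-walk {L = suc (suc ℓ)} {x = x} _ x~s s~s s~b _ =
  subst (Walk x b) (cong suc (ℕ.+-comm ℓ 1))
    (step (inj₁ (x~s zero refl))
      (walk-along s~s ℓ zero (fromℕ ℓ) (sym (toℕ-fromℕ ℓ))
        ++ʷ step (inj₁ (s~b (fromℕ ℓ) (cong suc (toℕ-fromℕ ℓ)))) here))

u-u'-dist-via-b : ∀ {k n L Lp} {i j : Fin k} {c e : Fin n} {m} → 1 ℕ.≤ L →
                  IsDist {k} {n} {L} {Lp} (u i c) (u' j e) m → m ℕ.≤ L + L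
u-u'-dist-via-b {i = i} {j} {c} {e} 1≤L (_ , shortest) =
  shortest _ (spoke-walk (e-ub₀ i c) (e-ub₁ i c) (e-ubub i c) (e-ubb i c) 1≤L
              ++ʷ reverseʷ (spoke-walk (e-u'b₀ j e) (e-u'b₁ j e) (e-u'bu'b j e) (e-u'bb j e) 1≤L))

private
  x<y≤N⇒[N∸y]+[2+x]≤1+N : ∀ {x y N} → x ℕ.< y → y ℕ.≤ N → (N ∸ y) + suc (suc x) ℕ.≤ suc N
  x<y≤N⇒[N∸y]+[2+x]≤1+N {x} {y} {N} x<y y≤N = begin
      (N ∸ y) + suc (suc x)    ≡⟨ ℕ.+-comm (N ∸ y) (suc (suc x)) ⟩
      suc (suc (x + (N ∸ y)))  ≤⟨ s≤s (ℕ.+-monoˡ-< (N ∸ y) x<y) ⟩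
      suc (y + (N ∸ y))        ≡⟨ cong suc (ℕ.m+[n∸m]≡n y≤N) ⟩
      suc N                    ∎
    where open ℕ.≤-Reasoning

  toℕ+[n∸toℕ]≡toℕ-fromℕ : ∀ {n} (x : Fin (suc n)) → toℕ x + (n ∸ toℕ x) ≡ toℕ (fromℕ n)
  toℕ+[n∸toℕ]≡toℕ-fromℕ {n} x = trans (ℕ.m+[n∸m]≡n (toℕ≤pred[n] x)) (sym (toℕ-fromℕ n))

u'-u-dist-around-cycle : ∀ {k n L Lp} {i : Fin k} {a c : Fin n} {m} → a ≢ c →
                         IsDist {k} {n} {L} {Lp} (u' i a) (u i c) m → m ℕ.≤ n
u'-u-dist-around-cycle {n = zero} {a = ()}
u'-u-dist-around-cycle {n = suc n′} {i = i} {a} {c} a≢c (_ , shortest)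
  with ℕ.<-cmp (toℕ a) (toℕ c)
... | tri≈ _ a≡c _ = ⊥-elim (a≢c (toℕ-injective a≡c))
... | tri< a<c _ _ =
  ℕ.≤-trans (shortest _ (reverseʷ via-z)) (x<y≤N⇒[N∸y]+[2+x]≤1+N a<c (toℕ≤pred[n] c))
  where
    via-z = walk-along (e-uu i) (n′ ∸ toℕ c) c (fromℕ n′) (toℕ+[n∸toℕ]≡toℕ-fromℕ c)
            ++ʷ step (inj₂ (e-zu i (fromℕ n′) (cong suc (toℕ-fromℕ n′))))
                  (step (inj₁ (e-zu' i zero refl)) (walk-along (e-u'u' i) (toℕ a) zero a refl))
... | tri> _ _ c<a =
  ℕ.≤-trans (shortest _ via-z′) (x<y≤N⇒[N∸y]+[2+x]≤1+N c<a (toℕ≤pred[n] a))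
  where
    via-z′ = walk-along (e-u'u' i) (n′ ∸ toℕ a) a (fromℕ n′) (toℕ+[n∸toℕ]≡toℕ-fromℕ a)
             ++ʷ step (inj₂ (e-z'u' i (fromℕ n′) (cong suc (toℕ-fromℕ n′))))
                   (step (inj₁ (e-z'u i zero refl)) (walk-along (e-uu i) (toℕ c) zero c refl))

private
  i≤-⌊-i/d⌋*d : ∀ i d → i ℤ.* + 1 ℤ.≤ ℤ.- ((ℤ.- i) ℤ./ + suc d) ℤ.* + suc d
  i≤-⌊-i/d⌋*d i d = begin
      i ℤ.* + 1                              ≡⟨ ℤ.*-identityʳ i ⟩
      i                                      ≡⟨ ℤ.neg-involutive i ⟨
      ℤ.- (ℤ.- i)                            ≤⟨ ℤ.neg-mono-≤ ([n/d]*d≤n (ℤ.- i) (+ suc d)) ⟩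
      ℤ.- ((ℤ.- i) ℤ./ + suc d ℤ.* + suc d)  ≡⟨ ℤ.neg-distribˡ-* ((ℤ.- i) ℤ./ + suc d) (+ suc d) ⟩
      ℤ.- ((ℤ.- i) ℤ./ + suc d) ℤ.* + suc d  ∎
    where open ℤ.≤-Reasoning

  i≤+∣i∣ : ∀ i → i ℤ.≤ + ∣ i ∣
  i≤+∣i∣ (+ _)    = ℤ.≤-refl
  i≤+∣i∣ -[1+ _ ] = ℤ.-≤+

p≤⌈p⌉ : ∀ p → toℚᵘ p ᵘ.≤ mkℚᵘ (ceiling p) 0
p≤⌈p⌉ (mkℚ (+ 0) d _)    = *≤* (i≤-⌊-i/d⌋*d (+ 0) d)
p≤⌈p⌉ (mkℚ +[1+ m ] d _) = *≤* (i≤-⌊-i/d⌋*d +[1+ m ] d)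
p≤⌈p⌉ (mkℚ -[1+ m ] d _) = *≤* (i≤-⌊-i/d⌋*d -[1+ m ] d)

Lof-≥-n/2α : ∀ n α (hα : 0ℚ < α) → n ℕ.* ↧ₙ α ℕ.≤ Lof n α hα ℕ.* (2 ℕ.* ∣ ↥ α ∣)
Lof-≥-n/2α n (mkℚ (+ 0) _ _)    hα with () ← positive hα
Lof-≥-n/2α n (mkℚ -[1+ _ ] _ _) hα with () ← positive hα
Lof-≥-n/2α n α@(mkℚ +[1+ a ] r _) hα =
  ℤ.drop‿+≤+ (subst₂ ℤ._≤_ (trans (ℤ.*-identityʳ _) (sym (ℤ.pos-* n (suc r)))) (sym (ℤ.pos-* L _))
                           (ᵘ.drop-*≤* n/2α≤L))
  where
    L = Lof n α hα
    p = (+ n Q./ 2) * Q.1/ α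
    n/2α≤L : mkℚᵘ (+ n) 1 ᵘ.* mkℚᵘ +[1+ r ] a ᵘ.≤ mkℚᵘ (+ L) 0
    n/2α≤L = begin
      mkℚᵘ (+ n) 1 ᵘ.* mkℚᵘ +[1+ r ] a   ≃⟨ ᵘ.*-cong (Q.toℚᵘ-fromℚᵘ (mkℚᵘ (+ n) 1)) ᵘ.≃-refl ⟨
      toℚᵘ (+ n Q./ 2) ᵘ.* toℚᵘ (Q.1/ α) ≃⟨ Q.toℚᵘ-homo-* (+ n Q./ 2) (Q.1/ α) ⟨
      toℚᵘ p                             ≤⟨ p≤⌈p⌉ p ⟩
      mkℚᵘ (ceiling p) 0                 ≤⟨ *≤* (ℤ.*-monoʳ-≤-nonNeg (+ 1) (i≤+∣i∣ (ceiling p))) ⟩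
      mkℚᵘ (+ L) 0                       ∎
      where open ᵘ.≤-Reasoning

1≤Lof : ∀ n α (hα : 0ℚ < α) → 1 ℕ.≤ n → 1 ℕ.≤ Lof n α hα
1≤Lof n α hα 1≤n with Lof n α hα | Lof-≥-n/2α n α hα
... | suc _ | _     = s≤s z≤n
... | zero  | n↧α≤0 = ℕ.≤-trans (ℕ.*-mono-≤ 1≤n (s≤s z≤n)) n↧α≤0

ℕtoℚ≤[1+α]*ℕtoℚ : ∀ α → 0ℚ ≤ α → ∀ {s d} → s ℕ.* ↧ₙ α ℕ.≤ (↧ₙ α + ∣ ↥ α ∣) ℕ.* d →
                ℕtoℚ s ≤ (1ℚ Q.+ α) * ℕtoℚ d
ℕtoℚ≤[1+α]*ℕtoℚ (mkℚ -[1+ _ ] _ _) 0≤α with () ← nonNegative 0≤α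
ℕtoℚ≤[1+α]*ℕtoℚ α@(mkℚ (+ a) r _) _ {s} {d} h = Q.toℚᵘ-cancel-≤ (let open ᵘ.≤-Reasoning in begin
    toℚᵘ (ℕtoℚ s)                         ≃⟨ Q.toℚᵘ-fromℚᵘ (mkℚᵘ (+ s) 0) ⟩
    mkℚᵘ (+ s) 0                          ≤⟨ *≤* cross-multiplied ⟩
    (ᵘ.1ℚᵘ ᵘ.+ toℚᵘ α) ᵘ.* mkℚᵘ (+ d) 0   ≃⟨ ᵘ.*-cong (Q.toℚᵘ-homo-+ 1ℚ α) (Q.toℚᵘ-fromℚᵘ (mkℚᵘ (+ d) 0)) ⟨
    toℚᵘ (1ℚ Q.+ α) ᵘ.* toℚᵘ (ℕtoℚ d)     ≃⟨ Q.toℚᵘ-homo-* (1ℚ Q.+ α) (ℕtoℚ d) ⟨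
    toℚᵘ ((1ℚ Q.+ α) * ℕtoℚ d)            ∎)
  where
    unit-factors : ∀ x y z → (x ℤ.+ y) ℤ.* z ≡ ((+ 1 ℤ.* x ℤ.+ y ℤ.* + 1) ℤ.* z) ℤ.* + 1
    unit-factors = solve-∀ℤ
    cross-multiplied : + s ℤ.* + (1 ℕ.* suc r ℕ.* 1) ℤ.≤ ((+ 1 ℤ.* + suc r ℤ.+ + a ℤ.* + 1) ℤ.* + d) ℤ.* + 1
    cross-multiplied = let open ℤ.≤-Reasoning in begin
      + s ℤ.* + (1 ℕ.* suc r ℕ.* 1)  ≡⟨ cong (λ m → + s ℤ.* + m) (trans (ℕ.*-identityʳ _) (ℕ.*-identityˡ _)) ⟩
      + s ℤ.* + suc r                ≡⟨ ℤ.pos-* s (suc r) ⟨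
      + (s ℕ.* suc r)                ≤⟨ ℤ.+≤+ h ⟩
      + ((suc r + a) ℕ.* d)          ≡⟨ ℤ.pos-* (suc r + a) d ⟩
      + (suc r + a) ℤ.* + d          ≡⟨ cong (ℤ._* + d) (ℤ.pos-+ (suc r) a) ⟩
      (+ suc r ℤ.+ + a) ℤ.* + d      ≡⟨ unit-factors (+ suc r) (+ a) (+ d) ⟩
      ((+ 1 ℤ.* + suc r ℤ.+ + a ℤ.* + 1) ℤ.* + d) ℤ.* + 1 ∎

n+2L≤[B+A]*d : ∀ n L A B {s d} → n ℕ.* B ℕ.≤ L ℕ.* (2 ℕ.* A) → s ℕ.≤ n + (L + L) → L + L ℕ.≤ d →
               s ℕ.* B ℕ.≤ (B + A) ℕ.* d
n+2L≤[B+A]*d n L A B {s} {d} nB≤2LA s≤n+2L 2L≤d = begin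
    s ℕ.* B                          ≤⟨ ℕ.*-monoˡ-≤ B s≤n+2L ⟩
    (n + (L + L)) ℕ.* B              ≡⟨ ℕ.*-distribʳ-+ B n (L + L) ⟩
    n ℕ.* B + (L + L) ℕ.* B          ≤⟨ ℕ.+-monoˡ-≤ ((L + L) ℕ.* B) nB≤2LA ⟩
    L ℕ.* (2 ℕ.* A) + (L + L) ℕ.* B  ≡⟨ regroup L A B ⟩
    (B + A) ℕ.* (L + L)              ≤⟨ ℕ.*-monoʳ-≤ (B + A) 2L≤d ⟩
    (B + A) ℕ.* d                    ∎
  where
    open ℕ.≤-Reasoning
    regroup : ∀ L A B → L ℕ.* (2 ℕ.* A) + (L + L) ℕ.* B ≡ (B + A) ℕ.* (L + L)
    regroup = solve-∀

stretch-bound : ∀ n α (hα : 0ℚ < α) {s d} → s ℕ.≤ n + (Lof n α hα + Lof n α hα) →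
                Lof n α hα + Lof n α hα ℕ.≤ d → ℕtoℚ s ≤ (1ℚ Q.+ α) * ℕtoℚ d
stretch-bound n α hα {s} {d} s≤n+2L 2L≤d =
  ℕtoℚ≤[1+α]*ℕtoℚ α (Q.<⇒≤ hα) {s} {d}
    (n+2L≤[B+A]*d n (Lof n α hα) ∣ ↥ α ∣ (↧ₙ α) (Lof-≥-n/2α n α hα) s≤n+2L 2L≤d)

lemma9 : (k n : ℕ) (α : ℚ) → k ≥ 2 → n % 2 ≡ 1 → (hα : 0ℚ < α) → α ≤ ½ →
    (i j : Fin k) → i ≢ j →
    (i′ i″ : Fin n) → i′ ≢ i″ →
    (j′ j″ : Fin n) → j′ ≢ j″ →
    (d₀ d₁ d₂ d₃ d₄ : ℕ) →
    dG' k n α hα (u' i i′) (u' j j′) d₀ →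
    dG' k n α hα (u' i i′) (u i i″) d₁ →
    dG' k n α hα (u i i″) (u' j j′) d₂ →
    dG' k n α hα (u' j j′) (u j j″) d₃ →
    dG' k n α hα (u j j″) (u' i i′) d₄ →
    (ℕtoℚ (d₁ + d₂) ≤ (1ℚ Q.+ α) * ℕtoℚ d₀)
    × (ℕtoℚ (d₃ + d₄) ≤ (1ℚ Q.+ α) * ℕtoℚ d₀)
lemma9 k n α _ _ hα _ i j i≢j i′ i″ i′≢i″ j′ j″ j′≢j″ d₀ d₁ d₂ d₃ d₄ D₀ D₁ D₂ D₃ D₄ =
  stretch-bound n α hα (detour i′≢i″ D₁ D₂) 2L≤d₀ ,
  stretch-bound n α hα (detour j′≢j″ D₃ D₄) 2L≤d₀
  where
    L = Lof n α hα
    1≤L : 1 ℕ.≤ L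
    1≤L = 1≤Lof n α hα (ℕ.≤-trans (s≤s z≤n) (toℕ<n i′))
    2L≤d₀ : L + L ℕ.≤ d₀
    2L≤d₀ = cross-branch-walk refl refl i≢j (proj₁ D₀)
    detour : ∀ {i j a c e m m′} → a ≢ c →
             dG' k n α hα (u' i a) (u i c) m → dG' k n α hα (u i c) (u' j e) m′ → m + m′ ℕ.≤ n + (L + L)
    detour a≢c D D′ = ℕ.+-mono-≤ (u'-u-dist-around-cycle a≢c D) (u-u'-dist-via-b 1≤L D′)
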